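{- Let $\mathcal V$ be a variety with a distinguished constant $1$. The following are equivalent: (1) every $\mathcal V$-unifiable term is $\mathcal V$-projective; (2) for every $n\in\mathbb N$ and every congruence $\varphi$ of $\mathbf F_n$ such that (a) $\varphi=\bigvee_{j=1}^k\Theta(\mathbf p_j,\mathbf 1)$ for some $p_1,\ldots,p_k\in T_{\mathcal F}(n)$, and (b) for every $s\in T_{\mathcal F}(n)$, if $(\mathbf s,\mathbf 1)\in\varphi$ then $s$ is $\mathcal V$-unifiable, the algebra $\mathbf F_n/\varphi$ is projective.
   Context: $T_{\mathcal F}(n)$ is the term algebra in $x_1,\dots,x_n$; $\mathbf F_n$ the free algebra of $\mathcal V$ on $\mathbf x_1,\dots,\mathbf x_n$; $\mathbf t$ the class of $t$; $\Theta(\mathbf p,\mathbf 1)$ the congruence of $\mathbf F_n$ generated by $(\mathbf p,\mathbf 1)$. A term $t\in T_{\mathcal F}(n)$ is $\mathcal V$-unifiable if there is a homomorphism $\sigma:\mathbf F_n\to\mathbf F_m$ with $\sigma(\mathbf t)=\mathbf 1$, and $\mathcal V$-projective if there is an endomorphism $\tau$ of $\mathbf F_n$ with $\tau(\mathbf t)=\mathbf 1$ and $(\tau(\mathbf x_i),\mathbf x_i)\in\Theta(\mathbf t,\mathbf 1)$ for all $i$. An algebra $\mathbf P\in\mathcal V$ is projective if for every surjective homomorphism $\beta:\mathbf B\to\mathbf C$ in $\mathcal V$ and every homomorphism $\gamma:\mathbf P\to\mathbf C$ there is a homomorphism $\alpha:\mathbf P\to\mathbf B$ with $\gamma=\beta\circ\alpha$.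 -}

module Defs where

open import Level using (0ℓ)
open import Data.Nat using (ℕ)
open import Data.Fin using (Fin)
open import Data.Empty using (⊥-elim)
open import Data.Product using (Σ; _×_; _,_)
open import Relation.Binary.PropositionalEquality using (_≡_; refl; subst)
open import Relation.Binary using (Setoid; IsEquivalence)
open import Function using (_∘_)

record Signature : Set₁ where
  field
    Op     : Set
    arity  : Op → ℕ
    one    : Op
    one-0  : arity one ≡ 0

module _ (Σ𝓕 : Signature) where
  open Signature Σ𝓕

  data Term (X : Set) : Set where
    var : X → Term X
    op  : (f : Op) → (Fin (arity f) → Term X) → Term X

record Variety : Set₁ where
  field
    sig    : Signature
    Ax     : Set
    nvars  : Ax → ℕ
    lhs rhs : (e : Ax) → Term sig (Fin (nvars e))
  open Signature sig public

  _[_] : ∀ {X Y : Set} → Term sig X → (X → Term sig Y) → Term sig Y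
  var x    [ ρ ] = ρ x
  op f ts  [ ρ ] = op f (λ i → ts i [ ρ ])

  oneT : ∀ {X : Set} → Term sig X
  oneT = op one (λ i → ⊥-elim (emp (subst Fin one-0 i)))
    where
      emp : Fin 0 → Data.Empty.⊥
      emp ()

  -- equational consequence of the identities of 𝓥 (the fully invariant
  -- congruence of the term algebra; T/⊢ is the 𝓥-free algebra)
  data _⊢_≈_ (X : Set) : Term sig X → Term sig X → Set where
    ⊢refl  : ∀ {s} → X ⊢ s ≈ s
    ⊢sym   : ∀ {s t} → X ⊢ s ≈ t → X ⊢ t ≈ s
    ⊢trans : ∀ {s t u} → X ⊢ s ≈ t → X ⊢ t ≈ u → X ⊢ s ≈ u
    ⊢cong  : ∀ f {ss ts : Fin (arity f) → Term sig X} →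
             (∀ i → X ⊢ ss i ≈ ts i) → X ⊢ op f ss ≈ op f ts
    ⊢ax    : ∀ (e : Ax) (ρ : Fin (nvars e) → Term sig X) →
             X ⊢ (lhs e [ ρ ]) ≈ (rhs e [ ρ ])

module _ (V : Variety) where
  open Variety V
  private T = Term sig

  record Algebra : Set₁ where
    field
      setoid : Setoid 0ℓ 0ℓ
    open Setoid setoid public
    field
      ⟦_⟧      : (f : Op) → (Fin (arity f) → Carrier) → Carrier
      ⟦⟧-cong : ∀ f {as bs : Fin (arity f) → Carrier} →
                (∀ i → as i ≈ bs i) → ⟦ f ⟧ as ≈ ⟦ f ⟧ bs

    eval : ∀ {X : Set} → (X → Carrier) → T X → Carrier
    eval ρ (var x)  = ρ x
    eval ρ (op f ts) = ⟦ f ⟧ (λ i → eval ρ (ts i))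

  InV : Algebra → Set
  InV A = ∀ (e : Ax) (ρ : Fin (nvars e) → Carrier) →
          eval ρ (lhs e) ≈ eval ρ (rhs e)
    where open Algebra A

  record Hom (A B : Algebra) : Set where
    private
      module A = Algebra A
      module B = Algebra B
    field
      ⟪_⟫      : A.Carrier → B.Carrier
      ⟪⟫-cong  : ∀ {a a'} → a A.≈ a' → ⟪_⟫ a B.≈ ⟪_⟫ a'
      ⟪⟫-hom   : ∀ f (as : Fin (arity f) → A.Carrier) →
                 ⟪_⟫ (A.⟦ f ⟧ as) B.≈ B.⟦ f ⟧ (⟪_⟫ ∘ as)
  open Hom public

  Surjective : {A B : Algebra} → Hom A B → Set
  Surjective {A} {B} h = ∀ (b : B.Carrier) → Σ A.Carrier λ a → ⟪ h ⟫ a B.≈ b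
    where
      module A = Algebra A
      module B = Algebra B

  -- P is projective (test algebras B, C ∈ 𝓥, with carriers in Set)
  Projective : Algebra → Set₁
  Projective P =
    ∀ (B C : Algebra) → InV B → InV C →
    (β : Hom B C) → Surjective β → (γ : Hom P C) →
    Σ (Hom P B) λ α → ∀ (a : Algebra.Carrier P) →
      Algebra._≈_ C (⟪ γ ⟫ a) (⟪ β ⟫ (⟪ α ⟫ a))

  F : ℕ → Algebra
  F n = record
    { setoid  = record
        { Carrier = T (Fin n)
        ; _≈_ = Fin n ⊢_≈_
        ; isEquivalence = record { refl = ⊢refl ; sym = ⊢sym ; trans = ⊢trans } }
    ; ⟦_⟧     = op
    ; ⟦⟧-cong = ⊢cong }

  TRel : ℕ → Set₁
  TRel n = T (Fin n) → T (Fin n) → Set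

  record Congruence (n : ℕ) : Set₁ where
    field
      R       : TRel n
      isEquiv : IsEquivalence R
      ⊇𝓥     : ∀ {s t} → Fin n ⊢ s ≈ t → R s t
      compat  : ∀ f {ss ts : Fin (arity f) → T (Fin n)} →
                (∀ i → R (ss i) (ts i)) → R (op f ss) (op f ts)

  data Cg {n : ℕ} (G : TRel n) : TRel n where
    gen    : ∀ {s t} → G s t → Cg G s t
    eqn    : ∀ {s t} → Fin n ⊢ s ≈ t → Cg G s t
    cgsym  : ∀ {s t} → Cg G s t → Cg G t s
    cgtrans : ∀ {s t u} → Cg G s t → Cg G t u → Cg G s u
    cgcong : ∀ f {ss ts : Fin (arity f) → T (Fin n)} →
             (∀ i → Cg G (ss i) (ts i)) → Cg G (op f ss) (op f ts)

  Θ : ∀ {n} → T (Fin n) → TRel n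
  Θ p = Cg (λ s t → (s ≡ p) × (t ≡ oneT))

  ⋁ : ∀ {n k} → (Fin k → TRel n) → TRel n
  ⋁ {k = k} θ = Cg (λ s t → Σ (Fin k) λ j → θ j s t)

  _/_ : (n : ℕ) → Congruence n → Algebra
  n / φ = record
    { setoid = record { Carrier = T (Fin n) ; _≈_ = R ; isEquivalence = isEquiv }
    ; ⟦_⟧ = op
    ; ⟦⟧-cong = compat }
    where open Congruence φ

  Unifiable : ∀ {n} → T (Fin n) → Set
  Unifiable {n} t = Σ ℕ λ m → Σ (Hom (F n) (F m)) λ σ →
                    Fin m ⊢ ⟪ σ ⟫ t ≈ oneT

  ProjectiveTerm : ∀ {n} → T (Fin n) → Set
  ProjectiveTerm {n} t = Σ (Hom (F n) (F n)) λ τ →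
    (Fin n ⊢ ⟪ τ ⟫ t ≈ oneT) × (∀ (i : Fin n) → Θ t (⟪ τ ⟫ (var i)) (var i))

-- A finite join φ of congruences Θ(pⱼ, 1) whose 1-class consists of unifiable
-- terms can be unified by a single endomorphism τ of Fₙ that is φ-equivalent to
-- the identity: having handled p₁, …, p_k, the image of p₀ is still φ-related
-- to 1, hence unifiable, hence projective, and composing with its projective
-- unifier preserves both properties.  Such a τ makes Fₙ/φ a retract of Fₙ, so
-- Fₙ/φ is projective.  Conversely, lifting the identity of Fₙ/Θ(t, 1) along the
-- quotient map yields a projective unifier of t.
module Submission where

open import Defs
open import Data.Nat using (ℕ; zero; suc)
open import Data.Fin using (Fin; zero; suc)
open import Data.Fin.Properties using (¬Fin0)
open import Data.Product using (Σ; _×_; _,_; proj₁; proj₂)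
open import Data.Empty using (⊥-elim)
open import Function.Bundles using (_⇔_; mk⇔)
open import Relation.Binary.PropositionalEquality using (_≡_; refl; subst)
open import Relation.Binary using (IsEquivalence)

module _ (V : Variety) where
  open Variety V

  private
    T : Set → Set
    T = Term sig

  Endo : ℕ → Set
  Endo n = Hom V (F V n) (F V n)

  idₕ : ∀ {A} → Hom V A A
  idₕ {A} = record { ⟪_⟫ = λ a → a ; ⟪⟫-cong = λ e → e ; ⟪⟫-hom = λ f as → Algebra.refl A }

  _∘ₕ_ : ∀ {A B C} → Hom V B C → Hom V A B → Hom V A C
  _∘ₕ_ {C = C} g h = record
    { ⟪_⟫     = λ a → ⟪ g ⟫ (⟪ h ⟫ a)
    ; ⟪⟫-cong = λ e → ⟪⟫-cong g (⟪⟫-cong h e)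
    ; ⟪⟫-hom  = λ f as → Algebra.trans C (⟪⟫-cong g (⟪⟫-hom h f as)) (⟪⟫-hom g f _) }

  hom-oneT : ∀ {n m} (h : Hom V (F V n) (F V m)) → Fin m ⊢ ⟪ h ⟫ oneT ≈ oneT
  hom-oneT h = ⊢trans (⟪⟫-hom h one _) (⊢cong one (λ i → ⊥-elim (¬Fin0 (subst Fin one-0 i))))

  module _ {n : ℕ} where

    open Congruence

    Cg-congruence : TRel V n → Congruence V n
    Cg-congruence G = record
      { R       = Cg V G
      ; isEquiv = record { refl = eqn ⊢refl ; sym = cgsym ; trans = cgtrans }
      ; ⊇𝓥     = eqn
      ; compat  = cgcong }

    Θ-congruence : T (Fin n) → Congruence V n
    Θ-congruence p = Cg-congruence (λ s t → (s ≡ p) × (t ≡ oneT))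

    identities : Congruence V n
    identities = record
      { R       = Fin n ⊢_≈_
      ; isEquiv = record { refl = ⊢refl ; sym = ⊢sym ; trans = ⊢trans }
      ; ⊇𝓥     = λ e → e
      ; compat  = ⊢cong }

    kernel : ∀ {m} → Hom V (F V n) (F V m) → Congruence V n
    kernel {m} h = record
      { R       = λ s t → Fin m ⊢ ⟪ h ⟫ s ≈ ⟪ h ⟫ t
      ; isEquiv = record { refl = ⊢refl ; sym = ⊢sym ; trans = ⊢trans }
      ; ⊇𝓥     = ⟪⟫-cong h
      ; compat  = λ f rs → ⊢trans (⟪⟫-hom h f _) (⊢trans (⊢cong f rs) (⊢sym (⟪⟫-hom h f _))) }

    Cg-least : ∀ {G} (ψ : Congruence V n) → (∀ {s t} → G s t → R ψ s t) →
               ∀ {s t} → Cg V G s t → R ψ s t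
    Cg-least ψ G⊆ψ (gen g)       = G⊆ψ g
    Cg-least ψ G⊆ψ (eqn e)       = ⊇𝓥 ψ e
    Cg-least ψ G⊆ψ (cgsym c)     = IsEquivalence.sym (isEquiv ψ) (Cg-least ψ G⊆ψ c)
    Cg-least ψ G⊆ψ (cgtrans c d) = IsEquivalence.trans (isEquiv ψ) (Cg-least ψ G⊆ψ c) (Cg-least ψ G⊆ψ d)
    Cg-least ψ G⊆ψ (cgcong f cs) = compat ψ f (λ i → Cg-least ψ G⊆ψ (cs i))

    Θ-least : ∀ (ψ : Congruence V n) {p} → R ψ p oneT → ∀ {s t} → Θ V p s t → R ψ s t
    Θ-least ψ p≈1 = Cg-least ψ λ { (refl , refl) → p≈1 }

    ⋁Θ-least : ∀ (ψ : Congruence V n) {k} {p : Fin k → T (Fin n)} → (∀ j → R ψ (p j) oneT) →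
               ∀ {s t} → ⋁ V (λ j → Θ V (p j)) s t → R ψ s t
    ⋁Θ-least ψ p≈1 = Cg-least ψ λ { (j , θ) → Θ-least ψ (p≈1 j) θ }

    Θ≡⋁-singleton : ∀ (p : T (Fin n)) s t →
                    (Θ V p s t → ⋁ V (λ (_ : Fin 1) → Θ V p) s t) ×
                    (⋁ V (λ (_ : Fin 1) → Θ V p) s t → Θ V p s t)
    Θ≡⋁-singleton p s t = (λ θ → gen (zero , θ)) , Cg-least (Θ-congruence p) λ { (_ , θ) → θ }

    ≈-id-on-generators⇒≈-id : ∀ (ψ : Congruence V n) (τ : Endo n) →
                              (∀ i → R ψ (⟪ τ ⟫ (var i)) (var i)) → ∀ s → R ψ (⟪ τ ⟫ s) s
    ≈-id-on-generators⇒≈-id ψ τ τx≈x (var i)   = τx≈x i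
    ≈-id-on-generators⇒≈-id ψ τ τx≈x (op f ts) =
      IsEquivalence.trans (isEquiv ψ) (⊇𝓥 ψ (⟪⟫-hom τ f ts))
        (compat ψ f (λ i → ≈-id-on-generators⇒≈-id ψ τ τx≈x (ts i)))

    quotient-map : (φ : Congruence V n) → Hom V (F V n) (_/_ V n φ)
    quotient-map φ = record { ⟪_⟫ = λ a → a ; ⟪⟫-cong = ⊇𝓥 φ ; ⟪⟫-hom = λ f as → ⊇𝓥 φ ⊢refl }

  quotient-inV : ∀ {n} (φ : Congruence V n) → InV V (_/_ V n φ)
  quotient-inV {n} φ e ρ = trans (eval-≈-subst (lhs e)) (trans (⊇𝓥 (⊢ax e ρ)) (sym (eval-≈-subst (rhs e))))
    where
      open Congruence φ
      open IsEquivalence isEquiv renaming (refl to ≈-refl)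
      eval-≈-subst : ∀ t → R (Algebra.eval (_/_ V n φ) ρ t) (t [ ρ ])
      eval-≈-subst (var x)   = ≈-refl
      eval-≈-subst (op f ts) = compat f (λ i → eval-≈-subst (ts i))

  -- Fₙ and Fₙ / identities are the same record up to η.
  F-inV : ∀ n → InV V (F V n)
  F-inV n = quotient-inV (identities {n})

  module _ (B : Algebra V) (B-inV : InV V B) where
    open Algebra B renaming (refl to ≈-refl)

    eval-subst : ∀ {X Y} (ρ : Y → Carrier) (σ : X → T Y) t →
                 eval ρ (t [ σ ]) ≈ eval (λ x → eval ρ (σ x)) t
    eval-subst ρ σ (var x)   = ≈-refl
    eval-subst ρ σ (op f ts) = ⟦⟧-cong f (λ i → eval-subst ρ σ (ts i))

    ⊢-sound : ∀ {X s t} → X ⊢ s ≈ t → ∀ (ρ : X → Carrier) → eval ρ s ≈ eval ρ t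
    ⊢-sound ⊢refl          ρ = ≈-refl
    ⊢-sound (⊢sym d)       ρ = sym (⊢-sound d ρ)
    ⊢-sound (⊢trans d d′)  ρ = trans (⊢-sound d ρ) (⊢-sound d′ ρ)
    ⊢-sound (⊢cong f ds)   ρ = ⟦⟧-cong f (λ i → ⊢-sound (ds i) ρ)
    ⊢-sound (⊢ax e σ)      ρ =
      trans (eval-subst ρ σ (lhs e)) (trans (B-inV e _) (sym (eval-subst ρ σ (rhs e))))

  eval-commutes : ∀ {n} (φ : Congruence V n) {B C : Algebra V}
                  (β : Hom V B C) (γ : Hom V (_/_ V n φ) C) (b : Fin n → Algebra.Carrier B) →
                  (∀ i → Algebra._≈_ C (⟪ β ⟫ (b i)) (⟪ γ ⟫ (var i))) →
                  ∀ u → Algebra._≈_ C (⟪ β ⟫ (Algebra.eval B b u)) (⟪ γ ⟫ u)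
  eval-commutes φ β γ b βb≈γx (var i)   = βb≈γx i
  eval-commutes φ {C = C} β γ b βb≈γx (op f ts) =
    trans (⟪⟫-hom β f _) (trans (⟦⟧-cong f (λ i → eval-commutes φ β γ b βb≈γx (ts i))) (sym (⟪⟫-hom γ f ts)))
    where open Algebra C

  -- α reads τ as a map Fₙ/φ → Fₙ and then evaluates at β-preimages of γ's
  -- values on the generators.
  retraction⇒projective : ∀ {n} (φ : Congruence V n) (τ : Endo n) →
    (∀ {s t} → Congruence.R φ s t → Fin n ⊢ ⟪ τ ⟫ s ≈ ⟪ τ ⟫ t) →
    (∀ i → Congruence.R φ (⟪ τ ⟫ (var i)) (var i)) →
    Projective V (_/_ V n φ)
  retraction⇒projective {n} φ τ φ⊆kerτ τx≈x B C B-inV _ β β-surj γ = α , γ≈βα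
    where
      open Algebra C
      b : Fin n → Algebra.Carrier B
      b i = proj₁ (β-surj (⟪ γ ⟫ (var i)))
      α : Hom V (_/_ V n φ) B
      α = record
        { ⟪_⟫     = λ a → Algebra.eval B b (⟪ τ ⟫ a)
        ; ⟪⟫-cong = λ r → ⊢-sound B B-inV (φ⊆kerτ r) b
        ; ⟪⟫-hom  = λ f as → ⊢-sound B B-inV (⟪⟫-hom τ f as) b }
      γ≈βα : ∀ a → ⟪ γ ⟫ a ≈ ⟪ β ⟫ (⟪ α ⟫ a)
      γ≈βα a = trans (⟪⟫-cong γ (IsEquivalence.sym (Congruence.isEquiv φ) (≈-id-on-generators⇒≈-id φ τ τx≈x a)))
                     (sym (eval-commutes φ β γ b (λ i → proj₂ (β-surj _)) (⟪ τ ⟫ a)))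

  UnifiesModulo : ∀ {n k} → Congruence V n → (Fin k → T (Fin n)) → Endo n → Set
  UnifiesModulo {n} φ p τ = (∀ j → Fin n ⊢ ⟪ τ ⟫ (p j) ≈ oneT) × (∀ i → Congruence.R φ (⟪ τ ⟫ (var i)) (var i))

  module _ (unifiable⇒projective : ∀ n (t : T (Fin n)) → Unifiable V t → ProjectiveTerm V t)
           {n} (φ : Congruence V n)
           (one-class-unifiable : ∀ s → Congruence.R φ s oneT → Unifiable V s) where

    open Congruence φ
    open IsEquivalence isEquiv renaming (refl to ≈-refl)

    unifier-modulo : ∀ k (p : Fin k → T (Fin n)) → (∀ j → R (p j) oneT) → Σ (Endo n) (UnifiesModulo φ p)
    unifier-modulo zero    p p≈1 = idₕ , (λ ()) , (λ i → ≈-refl)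
    unifier-modulo (suc k) p p≈1 = extend (unifier-modulo k (λ j → p (suc j)) (λ j → p≈1 (suc j)))
      where
        extend : Σ (Endo n) (UnifiesModulo φ (λ j → p (suc j))) → Σ (Endo n) (UnifiesModulo φ p)
        extend (τ₁ , τ₁p≈1 , τ₁x≈x) = τ₂ ∘ₕ τ₁ , τp≈1 , τx≈x
          where
            τ₁p₀≈1 : R (⟪ τ₁ ⟫ (p zero)) oneT
            τ₁p₀≈1 = trans (≈-id-on-generators⇒≈-id φ τ₁ τ₁x≈x (p zero)) (p≈1 zero)
            projective : ProjectiveTerm V (⟪ τ₁ ⟫ (p zero))
            projective = unifiable⇒projective n _ (one-class-unifiable _ τ₁p₀≈1)
            τ₂ = proj₁ projective
            τp≈1 : ∀ j → Fin n ⊢ ⟪ τ₂ ∘ₕ τ₁ ⟫ (p j) ≈ oneT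
            τp≈1 zero    = proj₁ (proj₂ projective)
            τp≈1 (suc j) = ⊢trans (⟪⟫-cong τ₂ (τ₁p≈1 j)) (hom-oneT τ₂)
            τx≈x : ∀ i → R (⟪ τ₂ ∘ₕ τ₁ ⟫ (var i)) (var i)
            τx≈x i = trans (Θ-least φ τ₁p₀≈1
                              (≈-id-on-generators⇒≈-id (Θ-congruence _) τ₂
                                (proj₂ (proj₂ projective)) (⟪ τ₁ ⟫ (var i))))
                           (τ₁x≈x i)

    finitely-generated-quotient-projective : ∀ k (p : Fin k → T (Fin n)) →
      (∀ s t → (R s t → ⋁ V (λ j → Θ V (p j)) s t) × (⋁ V (λ j → Θ V (p j)) s t → R s t)) →
      Projective V (_/_ V n φ)
    finitely-generated-quotient-projective k p φ≡⋁ =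
      retraction⇒projective φ τ
        (λ r → ⋁Θ-least (kernel τ) (λ j → ⊢trans (τp≈1 j) (⊢sym (hom-oneT τ))) (proj₁ (φ≡⋁ _ _) r))
        τx≈x
      where
        p≈1 : ∀ j → R (p j) oneT
        p≈1 j = proj₂ (φ≡⋁ (p j) oneT) (gen (j , gen (refl , refl)))
        unifier = unifier-modulo k p p≈1
        τ = proj₁ unifier
        τp≈1 = proj₁ (proj₂ unifier)
        τx≈x = proj₂ (proj₂ unifier)

  Θ-one-class-unifiable : ∀ {n} {t : T (Fin n)} → Unifiable V t → ∀ s → Θ V t s oneT → Unifiable V s
  Θ-one-class-unifiable (m , σ , σt≈1) s θ =
    m , σ , ⊢trans (Θ-least (kernel σ) (⊢trans σt≈1 (⊢sym (hom-oneT σ))) θ) (hom-oneT σ)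

  projective-quotient⇒projective-term : ∀ {n} (t : T (Fin n)) →
    Projective V (_/_ V n (Θ-congruence t)) → ProjectiveTerm V t
  projective-quotient⇒projective-term {n} t projective =
    τ , ⊢trans (⟪⟫-cong α (gen (refl , refl))) (hom-oneT τ) , λ i → cgsym (π≈α (var i))
    where
      lift = projective (F V n) (_/_ V n (Θ-congruence t)) (F-inV n) (quotient-inV (Θ-congruence t))
               (quotient-map (Θ-congruence t)) (λ b → b , eqn ⊢refl) idₕ
      α = proj₁ lift
      π≈α = proj₂ lift
      τ : Endo n
      τ = α ∘ₕ quotient-map (Θ-congruence t)

mainTheorem19 : (V : Variety) →
    (∀ (n : ℕ) (t : Term (Variety.sig V) (Fin n)) → Unifiable V t → ProjectiveTerm V t)
    ⇔
    (∀ (n : ℕ) (φ : Congruence V n) →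
    (Σ ℕ λ k → Σ (Fin k → Term (Variety.sig V) (Fin n)) λ p →
    ∀ s t → (Congruence.R φ s t → ⋁ V (λ j → Θ V (p j)) s t)
    × (⋁ V (λ j → Θ V (p j)) s t → Congruence.R φ s t)) →
    (∀ (s : Term (Variety.sig V) (Fin n)) → Congruence.R φ s (Variety.oneT V) → Unifiable V s) →
    Projective V (_/_ V n φ))
mainTheorem19 V = mk⇔
  (λ unifiable⇒projective n φ (k , p , φ≡⋁) one-class-unifiable →
     finitely-generated-quotient-projective V unifiable⇒projective φ one-class-unifiable k p φ≡⋁)
  (λ quotients-projective n t t-unifiable →
     projective-quotient⇒projective-term V t
       (quotients-projective n (Θ-congruence V t) (1 , (λ _ → t) , Θ≡⋁-singleton V t)
          (Θ-one-class-unifiable V t-unifiable)))
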